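{- Let $\delta>0$ and let $G=(V,E)$ be a finite simple undirected graph. If $x^{\mathcal{K}}$ is any independent clique solution of $\mathrm{LCP}_\delta(G)$ and $x$ is any solution of $\mathrm{LCP}_\delta(G)$ with support $\sigma(x)=V$, then $\|x\|_1\le\|x^{\mathcal{K}}\|_1$.
   Context: For a graph $G$ with adjacency matrix $A$ and $\delta>0$, $\mathrm{LCP}_\delta(G)$ is the problem: find $x\in\mathbb{R}^{V}$ with $x\ge0$, $(I+\delta A)x-\mathbf{e}\ge 0$, $x^\top((I+\delta A)x-\mathbf{e})=0$ ($\mathbf{e}$ the all-ones vector). $\sigma(x)=\{i:x_i>0\}$. Two cliques are independent if no vertex of one is adjacent to any vertex of the other. An independent clique solution is a solution whose support is a union of pairwise independent cliques. -}

module Defs where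

open import Level using (Level; _⊔_) renaming (suc to lsuc)
open import Data.Bool using (Bool; true; false; if_then_else_)
open import Data.Nat using (ℕ)
open import Data.Fin using (Fin)
open import Data.Fin.Subset using (Subset; _∈_)
open import Data.Product using (_×_; ∃-syntax; Σ-syntax)
open import Relation.Nullary using (¬_)
open import Relation.Binary.PropositionalEquality using (_≡_; _≢_)
open import Relation.Binary.Structures using (IsTotalOrder)
open import Algebra.Bundles using (CommutativeRing)
open import Algebra.Definitions.RawMonoid using (sum)

-- Ordered fields (the standard library has no reals and no ordered
-- fields; the paper works over ℝ, the prototypical ordered field).

record OrderedField c ℓ₁ ℓ₂ : Set (lsuc (c ⊔ ℓ₁ ⊔ ℓ₂)) where
  field
    commutativeRing : CommutativeRing c ℓ₁
  open CommutativeRing commutativeRing public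
  field
    _≤_          : Carrier → Carrier → Set ℓ₂
    isTotalOrder : IsTotalOrder _≈_ _≤_
    0≉1          : ¬ (0# ≈ 1#)
    inverse      : ∀ x → ¬ (x ≈ 0#) → ∃[ y ] (x * y ≈ 1#)
    +-monoˡ-≤    : ∀ {x y} z → x ≤ y → (x + z) ≤ (y + z)
    *-nonneg     : ∀ {x y} → 0# ≤ x → 0# ≤ y → 0# ≤ (x * y)

  _<_ : Carrier → Carrier → Set (ℓ₁ ⊔ ℓ₂)
  x < y = (x ≤ y) × ¬ (x ≈ y)

record Graph (n : ℕ) : Set where
  field
    adj     : Fin n → Fin n → Bool
    symmetric   : ∀ i j → adj i j ≡ adj j i
    irreflexive : ∀ i → adj i i ≡ false

module _ {c ℓ₁ ℓ₂} (F : OrderedField c ℓ₁ ℓ₂) where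
  open OrderedField F

  Σ′ : ∀ {n} → (Fin n → Carrier) → Carrier
  Σ′ = sum +-rawMonoid

  adjMatrix : ∀ {n} → Graph n → Fin n → Fin n → Carrier
  adjMatrix G i j = if Graph.adj G i j then 1# else 0#

  Mx : ∀ {n} → Graph n → Carrier → (Fin n → Carrier) → Fin n → Carrier
  Mx G δ x i = x i + δ * Σ′ (λ j → adjMatrix G i j * x j)

  IsLCPSolution : ∀ {n} → Graph n → Carrier → (Fin n → Carrier) → Set (ℓ₁ ⊔ ℓ₂)
  IsLCPSolution G δ x =
    (∀ i → 0# ≤ x i) ×
    (∀ i → 0# ≤ (Mx G δ x i - 1#)) ×
    (Σ′ (λ i → x i * (Mx G δ x i - 1#)) ≈ 0#)

  InSupport : ∀ {n} → (Fin n → Carrier) → Fin n → Set (ℓ₁ ⊔ ℓ₂)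
  InSupport x i = 0# < x i

  IsClique : ∀ {n} → Graph n → Subset n → Set
  IsClique G K = ∀ u v → u ∈ K → v ∈ K → u ≢ v → Graph.adj G u v ≡ true

  Independent : ∀ {n} → Graph n → Subset n → Subset n → Set
  Independent G K L = ∀ u v → u ∈ K → v ∈ L → Graph.adj G u v ≡ false

  IsIndependentCliqueSolution : ∀ {n} → Graph n → Carrier → (Fin n → Carrier) → Set (ℓ₁ ⊔ ℓ₂)
  IsIndependentCliqueSolution {n} G δ x =
    IsLCPSolution G δ x ×
    Σ[ k ∈ ℕ ] Σ[ K ∈ (Fin k → Subset n) ] (
      (∀ (a : Fin k) → IsClique G (K a)) ×
      (∀ (a b : Fin k) → a ≢ b → Independent G (K a) (K b)) ×
      (∀ i → (InSupport x i → ∃[ a ] (i ∈ K a)) × (∃[ a ] (i ∈ K a) → InSupport x i)))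

  -- ‖x‖₁ for nonnegative x (all LCP solutions are nonnegative)
  norm₁ : ∀ {n} → (Fin n → Carrier) → Carrier
  norm₁ x = Σ′ x

-- Write M = I + δA, a symmetric matrix. If x solves LCP_δ(G) with full support,
-- complementarity forces Mx = e. For any other solution y we have My ≥ e and x ≥ 0,
-- so ‖x‖₁ = xᵀe ≤ xᵀMy = yᵀMx = yᵀe = ‖y‖₁. Thus a full-support solution has the
-- least 1-norm among all solutions.
module Submission where

open import Defs
open import Data.Bool using (if_then_else_)
open import Data.Nat using (ℕ; zero; suc)
open import Data.Fin using (Fin)
open import Data.Product using (_,_; proj₂)
open import Relation.Nullary using (¬_)
open import Relation.Binary.Bundles using (Poset)
open import Relation.Binary.Structures using (IsTotalOrder)
import Relation.Binary.PropositionalEquality as ≡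
open import Algebra.Bundles using (CommutativeSemiring)
import Algebra.Properties.Group as GroupProperties
import Algebra.Properties.Ring as RingProperties
import Algebra.Properties.Semiring.Sum as SemiringSum
import Relation.Binary.Reasoning.Setoid as SetoidReasoning
import Relation.Binary.Reasoning.PartialOrder as PosetReasoning

module DotProduct {c ℓ} (R : CommutativeSemiring c ℓ) where
  open CommutativeSemiring R
  open SemiringSum semiring using (sum; ∑-comm; ∑-distrib-+; *-distribˡ-sum; sum-cong-≋)
  open SetoidReasoning setoid

  Vector : ℕ → Set c
  Vector n = Fin n → Carrier

  Matrix : ℕ → Set c
  Matrix n = Fin n → Fin n → Carrier

  SymmetricMatrix : ∀ {n} → Matrix n → Set ℓ
  SymmetricMatrix A = ∀ i j → A i j ≈ A j i

  _·_ : ∀ {n} → Vector n → Vector n → Carrier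
  x · y = sum (λ i → x i * y i)

  _*ᵥ_ : ∀ {n} → Matrix n → Vector n → Vector n
  (A *ᵥ y) i = sum (λ j → A i j * y j)

  ·-linearʳ : ∀ {n} (x y z : Vector n) δ → x · (λ i → y i + δ * z i) ≈ x · y + δ * (x · z)
  ·-linearʳ x y z δ = begin
    x · (λ i → y i + δ * z i)              ≈⟨ sum-cong-≋ (λ i → distribˡ (x i) (y i) (δ * z i)) ⟩
    sum (λ i → x i * y i + x i * (δ * z i)) ≈⟨ ∑-distrib-+ (λ i → x i * y i) (λ i → x i * (δ * z i)) ⟩
    x · y + sum (λ i → x i * (δ * z i))     ≈⟨ +-congˡ (sum-cong-≋ (λ i → x[δz]≈δ[xz] (x i) (z i))) ⟩
    x · y + sum (λ i → δ * (x i * z i))     ≈⟨ +-congˡ (*-distribˡ-sum δ (λ i → x i * z i)) ⟨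
    x · y + δ * (x · z)                     ∎
    where
    x[δz]≈δ[xz] : ∀ a b → a * (δ * b) ≈ δ * (a * b)
    x[δz]≈δ[xz] a b = trans (sym (*-assoc a δ b)) (trans (*-congʳ (*-comm a δ)) (*-assoc δ a b))

  ·-*ᵥ-symmetric : ∀ {n} {A : Matrix n} → SymmetricMatrix A →
                   ∀ x y → x · (A *ᵥ y) ≈ y · (A *ᵥ x)
  ·-*ᵥ-symmetric {A = A} A-sym x y = begin
    x · (A *ᵥ y)                      ≈⟨ sum-cong-≋ (λ i → *-distribˡ-sum (x i) (λ j → A i j * y j)) ⟩
    sum (λ i → sum (λ j → x i * (A i j * y j))) ≈⟨ ∑-comm (λ i j → x i * (A i j * y j)) ⟩
    sum (λ j → sum (λ i → x i * (A i j * y j))) ≈⟨ sum-cong-≋ (λ j → sum-cong-≋ (λ i → swap i j)) ⟩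
    sum (λ j → sum (λ i → y j * (A j i * x i))) ≈⟨ sum-cong-≋ (λ j → *-distribˡ-sum (y j) (λ i → A j i * x i)) ⟨
    y · (A *ᵥ x)                      ∎
    where
    swap : ∀ i j → x i * (A i j * y j) ≈ y j * (A j i * x i)
    swap i j = begin
      x i * (A i j * y j) ≈⟨ *-comm (x i) _ ⟩
      A i j * y j * x i   ≈⟨ *-congʳ (*-comm (A i j) (y j)) ⟩
      y j * A i j * x i   ≈⟨ *-assoc (y j) (A i j) (x i) ⟩
      y j * (A i j * x i) ≈⟨ *-congˡ (*-congʳ (A-sym i j)) ⟩
      y j * (A j i * x i) ∎

  ·-[I+δA]-symmetric : ∀ {n} {A : Matrix n} → SymmetricMatrix A → ∀ δ x y →
                       x · (λ i → y i + δ * (A *ᵥ y) i) ≈ y · (λ i → x i + δ * (A *ᵥ x) i)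
  ·-[I+δA]-symmetric {A = A} A-sym δ x y = begin
    x · (λ i → y i + δ * (A *ᵥ y) i) ≈⟨ ·-linearʳ x y (A *ᵥ y) δ ⟩
    x · y + δ * (x · (A *ᵥ y))       ≈⟨ +-cong (sum-cong-≋ (λ i → *-comm (x i) (y i)))
                                               (*-congˡ (·-*ᵥ-symmetric A-sym x y)) ⟩
    y · x + δ * (y · (A *ᵥ x))       ≈⟨ ·-linearʳ y x (A *ᵥ x) δ ⟨
    y · (λ i → x i + δ * (A *ᵥ x) i) ∎

module OrderedFieldProperties {c ℓ₁ ℓ₂} (F : OrderedField c ℓ₁ ℓ₂) where
  open OrderedField F
  open GroupProperties +-group using (//-rightDividesˡ; x∙y⁻¹≈ε⇒x≈y)
  open SetoidReasoning setoid

  poset : Poset c ℓ₁ ℓ₂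
  poset = record { isPartialOrder = IsTotalOrder.isPartialOrder isTotalOrder }

  open Poset poset public using (≤-respˡ-≈; ≤-respʳ-≈)
    renaming (refl to ≤-refl; trans to ≤-trans; antisym to ≤-antisym)

  +-monoʳ-≤ : ∀ {x y} z → x ≤ y → (z + x) ≤ (z + y)
  +-monoʳ-≤ {x} {y} z x≤y = ≤-respˡ-≈ (+-comm x z) (≤-respʳ-≈ (+-comm y z) (+-monoˡ-≤ z x≤y))

  +-mono-≤ : ∀ {x y u v} → x ≤ y → u ≤ v → (x + u) ≤ (y + v)
  +-mono-≤ {y = y} {u = u} x≤y u≤v = ≤-trans (+-monoˡ-≤ u x≤y) (+-monoʳ-≤ y u≤v)

  0≤x-y⇒y≤x : ∀ {x y} → 0# ≤ (x - y) → y ≤ x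
  0≤x-y⇒y≤x {x} {y} 0≤x-y =
    ≤-respˡ-≈ (+-identityˡ y) (≤-respʳ-≈ (//-rightDividesˡ y x) (+-monoˡ-≤ y 0≤x-y))

  x-y≈0⇒x≈y : ∀ {x y} → x - y ≈ 0# → x ≈ y
  x-y≈0⇒x≈y = x∙y⁻¹≈ε⇒x≈y _ _

  x+y≈0⇒x≈0 : ∀ {x y} → 0# ≤ x → 0# ≤ y → x + y ≈ 0# → x ≈ 0#
  x+y≈0⇒x≈0 {x} 0≤x 0≤y x+y≈0 =
    ≤-antisym (≤-respˡ-≈ (+-identityʳ x) (≤-respʳ-≈ x+y≈0 (+-monoʳ-≤ x 0≤y))) 0≤x

  x*y≈0⇒y≈0 : ∀ {x y} → ¬ x ≈ 0# → x * y ≈ 0# → y ≈ 0#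
  x*y≈0⇒y≈0 {x} {y} x≉0 xy≈0 with inverse x x≉0
  ... | x⁻¹ , xx⁻¹≈1 = begin
    y              ≈⟨ *-identityˡ y ⟨
    1# * y         ≈⟨ *-congʳ xx⁻¹≈1 ⟨
    x * x⁻¹ * y    ≈⟨ *-congʳ (*-comm x x⁻¹) ⟩
    x⁻¹ * x * y    ≈⟨ *-assoc x⁻¹ x y ⟩
    x⁻¹ * (x * y)  ≈⟨ *-congˡ xy≈0 ⟩
    x⁻¹ * 0#       ≈⟨ zeroʳ x⁻¹ ⟩
    0#             ∎

  x≤x*y : ∀ {x y} → 0# ≤ x → 0# ≤ (y - 1#) → x ≤ (x * y)
  x≤x*y {x} {y} 0≤x 0≤y-1 = 0≤x-y⇒y≤x (≤-respʳ-≈ x[y-1]≈xy-x (*-nonneg 0≤x 0≤y-1))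
    where
    open RingProperties ring using (x[y-z]≈xy-xz)
    x[y-1]≈xy-x : x * (y - 1#) ≈ x * y - x
    x[y-1]≈xy-x = trans (x[y-z]≈xy-xz x y 1#) (+-congˡ (-‿cong (*-identityʳ x)))

  sum-mono-≤ : ∀ {n} {f g : Fin n → Carrier} → (∀ i → f i ≤ g i) → Σ′ F f ≤ Σ′ F g
  sum-mono-≤ {zero}  f≤g = ≤-refl
  sum-mono-≤ {suc n} f≤g = +-mono-≤ (f≤g Fin.zero) (sum-mono-≤ (λ i → f≤g (Fin.suc i)))

  sum-nonneg : ∀ {n} {f : Fin n → Carrier} → (∀ i → 0# ≤ f i) → 0# ≤ Σ′ F f
  sum-nonneg {zero}  0≤f = ≤-refl
  sum-nonneg {suc n} 0≤f =
    ≤-respˡ-≈ (+-identityʳ 0#) (+-mono-≤ (0≤f Fin.zero) (sum-nonneg (λ i → 0≤f (Fin.suc i))))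

  sum-nonneg≈0⇒≈0 : ∀ {n} {f : Fin n → Carrier} → (∀ i → 0# ≤ f i) → Σ′ F f ≈ 0# → ∀ i → f i ≈ 0#
  sum-nonneg≈0⇒≈0 {suc n} {f} 0≤f Σf≈0 Fin.zero =
    x+y≈0⇒x≈0 (0≤f Fin.zero) (sum-nonneg (λ i → 0≤f (Fin.suc i))) Σf≈0
  sum-nonneg≈0⇒≈0 {suc n} {f} 0≤f Σf≈0 (Fin.suc i) =
    sum-nonneg≈0⇒≈0 (λ j → 0≤f (Fin.suc j)) tail≈0 i
    where
    tail≈0 : Σ′ F (λ j → f (Fin.suc j)) ≈ 0#
    tail≈0 = x+y≈0⇒x≈0 (sum-nonneg (λ j → 0≤f (Fin.suc j))) (0≤f Fin.zero)
                       (trans (+-comm _ (f Fin.zero)) Σf≈0)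

module LCPProperties {c ℓ₁ ℓ₂} (F : OrderedField c ℓ₁ ℓ₂) {n : ℕ} (G : Graph n)
                     (δ : OrderedField.Carrier F) where
  open OrderedField F
  open OrderedFieldProperties F
  open DotProduct commutativeSemiring using (_·_; SymmetricMatrix; ·-[I+δA]-symmetric)

  adjMatrix-symmetric : SymmetricMatrix (adjMatrix F G)
  adjMatrix-symmetric i j = reflexive (≡.cong (λ b → if b then 1# else 0#) (Graph.symmetric G i j))

  fullSupport⇒Mx≈1 : ∀ {x} → IsLCPSolution F G δ x → (∀ i → InSupport F x i) → ∀ i → Mx F G δ x i ≈ 1#
  fullSupport⇒Mx≈1 {x} (0≤x , 0≤Mx-1 , complementary) x>0 i =
    x-y≈0⇒x≈y (x*y≈0⇒y≈0 (λ x≈0 → proj₂ (x>0 i) (sym x≈0)) xᵢ[Mx-1]ᵢ≈0)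
    where
    xᵢ[Mx-1]ᵢ≈0 : x i * (Mx F G δ x i - 1#) ≈ 0#
    xᵢ[Mx-1]ᵢ≈0 = sum-nonneg≈0⇒≈0 (λ j → *-nonneg (0≤x j) (0≤Mx-1 j)) complementary i

  fullSupport-norm₁-minimal : ∀ {x y} → IsLCPSolution F G δ x → (∀ i → InSupport F x i) →
                              IsLCPSolution F G δ y → norm₁ F x ≤ norm₁ F y
  fullSupport-norm₁-minimal {x} {y} x-sol@(0≤x , _ , _) x>0 (_ , 0≤My-1 , _) = begin
    Σ′ F x               ≤⟨ sum-mono-≤ (λ i → x≤x*y (0≤x i) (0≤My-1 i)) ⟩
    x · Mx F G δ y       ≈⟨ ·-[I+δA]-symmetric adjMatrix-symmetric δ x y ⟩
    y · Mx F G δ x       ≈⟨ sum-cong-≋ (λ i → trans (*-congˡ (fullSupport⇒Mx≈1 x-sol x>0 i))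
                                                    (*-identityʳ (y i))) ⟩
    Σ′ F y               ∎
    where
    open PosetReasoning poset
    open SemiringSum semiring using (sum-cong-≋)

proposition4p11 : ∀ {c ℓ₁ ℓ₂} (F : OrderedField c ℓ₁ ℓ₂) {n : ℕ} (G : Graph n)
    (δ : OrderedField.Carrier F) → OrderedField._<_ F (OrderedField.0# F) δ →
    (xK x : _) → IsIndependentCliqueSolution F G δ xK →
    IsLCPSolution F G δ x → (∀ i → InSupport F x i) →
    OrderedField._≤_ F (norm₁ F x) (norm₁ F xK)
proposition4p11 F G δ _ xK x (xK-sol , _) x-sol x>0 =
  LCPProperties.fullSupport-norm₁-minimal F G δ x-sol x>0 xK-sol
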